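{- Let $(C_n,S)$ be an instance of cycle VCA and let $S'\subseteq S$ be an edge cover of $C_n$ (every vertex of $[n]$ is incident to some link of $S'$). Then $S'$ is feasible if and only if $S'$ is a circle component.
   Context: Let $n\ge 4$ and let $C_n$ be the cycle on $[n]$ with edges $\{i,i+1\}$ and $\{n,1\}$. A chord is an edge between two non-consecutive vertices of $C_n$. Chords $ab$, $cd$ with $a<b$, $c<d$ cross if $a,b,c,d$ are distinct and $c<a<d<b$ or $a<c<b<d$. An instance of cycle VCA is a pair $(C_n,S)$, $S$ a set of chords (links) with $C_n\cup S$ 3-vertex-connected; $S'\subseteq S$ is feasible if $C_n\cup S'$ is 3-vertex-connected. The circle graph of a set $L$ of chords has vertex set $L$, two chords adjacent iff they cross; $L$ is a circle component if its circle graph is connected. -}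

module Defs where

open import Data.Nat using (ℕ; suc; _≤_; _<_)
open import Data.Product using (_×_; Σ; proj₁; proj₂; _,_)
open import Data.Sum using (_⊎_)
open import Data.List using (List; length)
open import Data.List.Membership.Propositional using (_∈_; _∉_)
open import Relation.Binary.PropositionalEquality using (_≡_; _≢_)
open import Relation.Nullary using (¬_)

Vertex : ℕ → ℕ → Set
Vertex n v = 1 ≤ v × v ≤ n

-- A (candidate) chord is a pair (a , b), read as the edge ab with a < b.
Link : Set
Link = ℕ × ℕ

IsChord : ℕ → Link → Set
IsChord n (a , b) = 1 ≤ a × a < b × b ≤ n × b ≢ suc a × ¬ (a ≡ 1 × b ≡ n)

CycleAdj : ℕ → ℕ → ℕ → Set
CycleAdj n i j = (j ≡ suc i) ⊎ (i ≡ suc j) ⊎ (i ≡ 1 × j ≡ n) ⊎ (i ≡ n × j ≡ 1)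

Adj : ℕ → List Link → ℕ → ℕ → Set
Adj n L i j = CycleAdj n i j ⊎ (i , j) ∈ L ⊎ (j , i) ∈ L

-- Paths in a graph with edge relation E, all of whose vertices satisfy P
-- (the start vertex is checked separately by the caller).
data Path {A : Set} (P : A → Set) (E : A → A → Set) : A → A → Set where
  here : ∀ {x} → Path P E x x
  step : ∀ {x y z} → E x y → P y → Path P E y z → Path P E x z

Connected : {A : Set} → (A → Set) → (A → A → Set) → Set
Connected {A} P E = ∀ (x y : A) → P x → P y → Path P E x y

ThreeConnected : ℕ → List Link → Set
ThreeConnected n L =
  3 < n ×
  (∀ (X : List ℕ) → length X ≤ 2 →
     Connected (λ v → Vertex n v × v ∉ X) (Adj n L))

CycleVCAInstance : ℕ → List Link → Set
CycleVCAInstance n S =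
  4 ≤ n × (∀ c → c ∈ S → IsChord n c) × ThreeConnected n S

Feasible : ℕ → List Link → Set
Feasible n S' = ThreeConnected n S'

_⊆ₗ_ : List Link → List Link → Set
A ⊆ₗ B = ∀ c → c ∈ A → c ∈ B

EdgeCover : ℕ → List Link → Set
EdgeCover n S' =
  ∀ v → Vertex n v → Σ Link (λ c → c ∈ S' × (v ≡ proj₁ c ⊎ v ≡ proj₂ c))

Cross : Link → Link → Set
Cross (a , b) (c , d) = (c < a × a < d × d < b) ⊎ (a < c × c < b × b < d)

CircleComponent : List Link → Set
CircleComponent L = Connected (λ c → c ∈ L) Cross

module Submission where

-- A chord r straddles a pair x < y if one endpoint of r lies strictly between
-- x and y and the other strictly outside [x, y]; for chords this is the same as
-- crossing xy.  A path in the circle graph from a chord touching (x, y) to one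
-- touching the complement of [x, y] contains a straddling chord, because no
-- chord within [x, y] crosses a chord avoiding (x, y).
--
-- Circle component ⇒ feasible: deleting x ≤ y leaves the arc strictly between
-- them and the rest of the cycle, each traversed by cycle edges.  Links covering
-- a vertex of each arc are joined by a path in the circle graph, which yields a
-- straddling link joining the two arcs.
--
-- Feasible ⇒ circle component: let R be the crossing-closed component of a link.
-- For a chord xy, a path in C_n ∪ S' − {x, y} from the arc (x, y) to the rest
-- leaves the arc by a link straddling xy.  If x and y are endpoints of R, that
-- link has endpoints of R on both sides and so lies in R; thus R has endpoints
-- on both sides of xy.  For the chord spanned by the extreme endpoints of R this
-- is absurd unless 1 and n are endpoints of R.  Then a link d ∉ R has no
-- endpoint of R strictly inside, and the endpoints of R nearest to d on either
-- side span a chord with no endpoint of R between them, again absurd.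

open import Defs
open import Data.Nat using (ℕ; suc; _≤_; _<_; _≤′_; ≤′-refl; ≤′-step; z≤n; s≤s; _≟_; _≤?_; _<?_)
open import Data.Nat.Properties
open import Data.List using (List; []; _∷_; _++_; length; filter)
open import Data.List.Properties using (filter-notAll)
open import Data.List.Relation.Unary.Any as Any using (Any; here; there; any?)
open import Data.List.Membership.Propositional using (_∈_; _∉_; find; lose)
open import Data.List.Membership.Propositional.Properties using (∈-++⁺ˡ; ∈-++⁺ʳ; ∈-++⁻; ∈-filter⁺; ∈-filter⁻)
open import Data.Product using (Σ-syntax; ∃₂; _×_; _,_; proj₁; proj₂)
open import Data.Product.Properties using (≡-dec)
open import Data.Sum using (_⊎_; inj₁; inj₂; [_,_])
open import Data.Empty using (⊥; ⊥-elim)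
open import Data.Unit using (tt)
open import Function using (_∘_; id)
open import Function.Bundles using (_⇔_; mk⇔)
open import Induction.WellFounded using (Acc; acc)
open import Data.Nat.Induction using (<-wellFounded)
open import Relation.Binary using (TotalPreorder; DecidableEquality; tri<; tri≈; tri>)
import Relation.Binary.Construct.Flip.EqAndOrd as Flip
open import Relation.Binary.PropositionalEquality using (_≡_; _≢_; refl; sym; subst; subst₂)
open import Relation.Nullary using (¬_; Dec; yes; no)
open import Relation.Nullary.Decidable using (_×-dec_; _⊎-dec_; ¬?; decidable-stable)
open import Relation.Unary using (Decidable; U)
open import Relation.Unary.Properties using (U?)

module _ {A : Set} {E : A → A → Set} where

  weaken : {P Q : A → Set} → (∀ {v} → P v → Q v) → ∀ {x y} → Path P E x y → Path Q E x y
  weaken f here = here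
  weaken f (step e p r) = step e (f p) (weaken f r)

  infixr 5 _++ₚ_
  _++ₚ_ : {P : A → Set} → ∀ {x y z} → Path P E x y → Path P E y z → Path P E x z
  here ++ₚ q = q
  step e p r ++ₚ q = step e p (r ++ₚ q)

  snoc : {P : A → Set} → ∀ {x y z} → Path P E x y → E y z → P z → Path P E x z
  snoc r e pz = r ++ₚ step e pz here

  reverse : {P : A → Set} → (∀ {a b} → E a b → E b a) → ∀ {x y} → P x → Path P E x y → Path P E y x
  reverse sym-E px here = here
  reverse sym-E px (step e py r) = snoc (reverse sym-E py r) (sym-E e) px

  firstEntry : {P Q : A → Set} → Decidable Q → ∀ {x y} → P x → Path P E x y → ¬ Q x → Q y →
               ∃₂ λ p q → (P p × ¬ Q p) × E p q × (P q × Q q)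
  firstEntry Q? px here ¬qx qy = ⊥-elim (¬qx qy)
  firstEntry Q? px (step {y = v} e pv r) ¬qx qy with Q? v
  ... | yes qv = _ , v , (px , ¬qx) , e , (pv , qv)
  ... | no ¬qv = firstEntry Q? pv r ¬qv qy

module _ {c ℓ₁ ℓ₂} (O : TotalPreorder c ℓ₁ ℓ₂) where
  open TotalPreorder O using (_≲_; total) renaming (Carrier to A; refl to ≲-refl; trans to ≲-trans)

  Greatest : ∀ {p} → (A → Set p) → List A → Set _
  Greatest P xs = Σ[ m ∈ A ] m ∈ xs × P m × (∀ {v} → v ∈ xs → P v → v ≲ m)

  greatest-∷ : ∀ {p} {P : A → Set p} {x xs} → Dec (P x) → Greatest P xs → Greatest P (x ∷ xs)
  greatest-∷ (no ¬px) (m , m∈ , pm , ≲m) =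
    m , there m∈ , pm , λ { (here refl) px → ⊥-elim (¬px px) ; (there v∈) pv → ≲m v∈ pv }
  greatest-∷ {x = x} (yes px) (m , m∈ , pm , ≲m) with total x m
  ... | inj₁ x≲m = m , there m∈ , pm , λ { (here refl) _ → x≲m ; (there v∈) pv → ≲m v∈ pv }
  ... | inj₂ m≲x = x , here refl , px , λ { (here refl) _ → ≲-refl ; (there v∈) pv → ≲-trans (≲m v∈ pv) m≲x }

  greatest : ∀ {p} {P : A → Set p} → Decidable P → (xs : List A) → Any P xs → Greatest P xs
  greatest P? (x ∷ xs) (there pxs) = greatest-∷ (P? x) (greatest P? xs pxs)
  greatest P? (x ∷ xs) (here px) with any? P? xs
  ... | yes pxs = greatest-∷ (yes px) (greatest P? xs pxs)
  ... | no ¬pxs = x , here refl , px , λ { (here refl) _ → ≲-refl ; (there v∈) pv → ⊥-elim (¬pxs (lose v∈ pv)) }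

Least : ∀ {p} → (ℕ → Set p) → List ℕ → Set p
Least = Greatest (Flip.totalPreorder ≤-totalPreorder)

least : ∀ {p} {P : ℕ → Set p} → Decidable P → (xs : List ℕ) → Any P xs → Least P xs
least = greatest (Flip.totalPreorder ≤-totalPreorder)

Inside : Link → ℕ → Set
Inside (x , y) v = x < v × v < y

Outside : Link → ℕ → Set
Outside (x , y) v = v < x ⊎ y < v

Touches : (ℕ → Set) → Link → Set
Touches P (a , b) = P a ⊎ P b

Straddles : Link → Link → Set
Straddles e (a , b) = (Inside e a × Outside e b) ⊎ (Outside e a × Inside e b)

inside? : ∀ e → Decidable (Inside e)
inside? (x , y) v = (x <? v) ×-dec (v <? y)

outside? : ∀ e → Decidable (Outside e)
outside? (x , y) v = (v <? x) ⊎-dec (y <? v)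

touches? : {P : ℕ → Set} → Decidable P → Decidable (Touches P)
touches? P? (a , b) = P? a ⊎-dec P? b

cross? : ∀ r e → Dec (Cross r e)
cross? (a , b) (c , d) = ((c <? a) ×-dec (a <? d) ×-dec (d <? b)) ⊎-dec ((a <? c) ×-dec (c <? b) ×-dec (b <? d))

link-≟ : DecidableEquality Link
link-≟ = ≡-dec _≟_ _≟_

cross-sym : ∀ {r e} → Cross r e → Cross e r
cross-sym (inj₁ c) = inj₂ c
cross-sym (inj₂ c) = inj₁ c

touches-endpoint : ∀ {P : ℕ → Set} {v} r → v ≡ proj₁ r ⊎ v ≡ proj₂ r → P v → Touches P r
touches-endpoint r (inj₁ refl) pv = inj₁ pv
touches-endpoint r (inj₂ refl) pv = inj₂ pv

inside⇒¬outside : ∀ {e v} → Inside e v → ¬ Outside e v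
inside⇒¬outside (x<v , _) (inj₁ v<x) = <-asym x<v v<x
inside⇒¬outside (_ , v<y) (inj₂ y<v) = <-asym v<y y<v

inside-or-outside : ∀ {x y v} → v ≢ x → v ≢ y → Inside (x , y) v ⊎ Outside (x , y) v
inside-or-outside {x} {y} {v} v≢x v≢y with <-cmp v x | <-cmp v y
... | tri< v<x _ _ | _            = inj₂ (inj₁ v<x)
... | tri≈ _ v≡x _ | _            = ⊥-elim (v≢x v≡x)
... | tri> _ _ x<v | tri< v<y _ _ = inj₁ (x<v , v<y)
... | tri> _ _ _   | tri≈ _ v≡y _ = ⊥-elim (v≢y v≡y)
... | tri> _ _ _   | tri> _ _ y<v = inj₂ (inj₂ y<v)

touches-both⇒straddles : ∀ {e r} → Touches (Inside e) r → Touches (Outside e) r → Straddles e r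
touches-both⇒straddles (inj₁ ia) (inj₁ oa) = ⊥-elim (inside⇒¬outside ia oa)
touches-both⇒straddles (inj₁ ia) (inj₂ ob) = inj₁ (ia , ob)
touches-both⇒straddles (inj₂ ib) (inj₁ oa) = inj₂ (oa , ib)
touches-both⇒straddles (inj₂ ib) (inj₂ ob) = ⊥-elim (inside⇒¬outside ib ob)

straddles⇒touches-inside : ∀ {e r} → Straddles e r → Touches (Inside e) r
straddles⇒touches-inside (inj₁ (ia , _)) = inj₁ ia
straddles⇒touches-inside (inj₂ (_ , ib)) = inj₂ ib

straddles⇒touches-outside : ∀ {e r} → Straddles e r → Touches (Outside e) r
straddles⇒touches-outside (inj₁ (_ , ob)) = inj₂ ob
straddles⇒touches-outside (inj₂ (oa , _)) = inj₁ oa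

cross⇒straddles : ∀ {r e} → Cross r e → Straddles e r
cross⇒straddles (inj₁ (s<a , a<t , t<b)) = inj₁ ((s<a , a<t) , inj₂ t<b)
cross⇒straddles (inj₂ (a<s , s<b , b<t)) = inj₂ (inj₁ a<s , (s<b , b<t))

straddles⇒cross : ∀ {a b e} → a < b → Straddles e (a , b) → Cross (a , b) e
straddles⇒cross a<b (inj₁ ((s<a , _) , inj₁ b<s))   = ⊥-elim (<-asym (<-trans s<a a<b) b<s)
straddles⇒cross a<b (inj₁ ((s<a , a<t) , inj₂ t<b)) = inj₁ (s<a , a<t , t<b)
straddles⇒cross a<b (inj₂ (inj₁ a<s , (s<b , b<t))) = inj₂ (a<s , s<b , b<t)
straddles⇒cross a<b (inj₂ (inj₂ t<a , (_ , b<t)))   = ⊥-elim (<-asym (<-trans a<b b<t) t<a)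

straddles-sym : ∀ {e s t} → s < t → Straddles e (s , t) → Straddles (s , t) e
straddles-sym s<t st = cross⇒straddles (cross-sym (straddles⇒cross s<t st))

within-crosses-no-avoider : ∀ {e r r′} → ¬ Touches (Outside e) r → ¬ Touches (Inside e) r′ → ¬ Cross r r′
within-crosses-no-avoider {x , y} {a , b} {c , d} ¬out ¬in = ¬in ∘ inner
  where
    x≤a : x ≤ a
    x≤a = ≮⇒≥ (λ a<x → ¬out (inj₁ (inj₁ a<x)))
    b≤y : b ≤ y
    b≤y = ≮⇒≥ (λ y<b → ¬out (inj₂ (inj₂ y<b)))
    inner : Cross (a , b) (c , d) → Touches (Inside (x , y)) (c , d)
    inner (inj₁ (_ , a<d , d<b)) = inj₂ (≤-<-trans x≤a a<d , <-≤-trans d<b b≤y)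
    inner (inj₂ (a<c , c<b , _)) = inj₁ (≤-<-trans x≤a a<c , <-≤-trans c<b b≤y)

straddler-on-path : ∀ {P : Link → Set} e {r r′} → Path P Cross r r′ → P r →
                    Touches (Inside e) r → Touches (Outside e) r′ → Σ[ s ∈ Link ] P s × Straddles e s
straddler-on-path e {r} path pr in-r out-r′ with touches? (outside? e) r
... | yes out-r = r , pr , touches-both⇒straddles in-r out-r
... | no ¬out-r with firstEntry (touches? (outside? e)) pr path ¬out-r out-r′
...   | s , s′ , (_ , ¬out-s) , s×s′ , (ps′ , out-s′) with touches? (inside? e) s′
...     | yes in-s′ = s′ , ps′ , touches-both⇒straddles in-s′ out-s′
...     | no ¬in-s′ = ⊥-elim (within-crosses-no-avoider ¬out-s ¬in-s′ s×s′)

chord-endpoints : ∀ {n a b} → IsChord n (a , b) → Vertex n a × Vertex n b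
chord-endpoints (1≤a , a<b , b≤n , _) = (1≤a , ≤-trans (<⇒≤ a<b) b≤n) , (≤-trans 1≤a (<⇒≤ a<b) , b≤n)

outside-corner : ∀ {n x y} → 1 ≤ x → y ≤ n → ¬ (x ≡ 1 × y ≡ n) → Outside (x , y) 1 ⊎ Outside (x , y) n
outside-corner {n} {x} {y} 1≤x y≤n ¬1n with x ≟ 1
... | no x≢1  = inj₁ (inj₁ (≤∧≢⇒< 1≤x (x≢1 ∘ sym)))
... | yes x≡1 = inj₂ (inj₂ (≤∧≢⇒< y≤n (λ y≡n → ¬1n (x≡1 , y≡n))))

adj-sym : ∀ {n L i j} → Adj n L i j → Adj n L j i
adj-sym (inj₁ (inj₁ e))                 = inj₁ (inj₂ (inj₁ e))
adj-sym (inj₁ (inj₂ (inj₁ e)))          = inj₁ (inj₁ e)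
adj-sym (inj₁ (inj₂ (inj₂ (inj₁ (a , b))))) = inj₁ (inj₂ (inj₂ (inj₂ (b , a))))
adj-sym (inj₁ (inj₂ (inj₂ (inj₂ (a , b))))) = inj₁ (inj₂ (inj₂ (inj₁ (b , a))))
adj-sym (inj₂ (inj₁ m))                 = inj₂ (inj₂ m)
adj-sym (inj₂ (inj₂ m))                 = inj₂ (inj₁ m)

cycle-edge-¬leaves : ∀ {n x y p q} → 1 ≤ x → y ≤ n → CycleAdj n p q → Inside (x , y) p → ¬ Outside (x , y) q
cycle-edge-¬leaves _ _ (inj₁ refl) (x<p , _) (inj₁ q<x)         = <-asym x<p (<-trans (n<1+n _) q<x)
cycle-edge-¬leaves _ _ (inj₁ refl) (_ , p<y) (inj₂ y<q)         = <⇒≱ p<y (≤-pred y<q)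
cycle-edge-¬leaves _ _ (inj₂ (inj₁ refl)) (x<p , _) (inj₁ q<x)  = <⇒≱ q<x (≤-pred x<p)
cycle-edge-¬leaves _ _ (inj₂ (inj₁ refl)) (_ , p<y) (inj₂ y<q)  = <-asym (<-trans y<q (n<1+n _)) p<y
cycle-edge-¬leaves 1≤x _ (inj₂ (inj₂ (inj₁ (refl , refl)))) (x<1 , _) _ = <⇒≱ x<1 1≤x
cycle-edge-¬leaves _ y≤n (inj₂ (inj₂ (inj₂ (refl , refl)))) (_ , n<y) _ = <⇒≱ n<y y≤n

leaving-link : ∀ {n L x y p q} → 1 ≤ x → y ≤ n → Adj n L p q → Inside (x , y) p → Outside (x , y) q →
               Σ[ e ∈ Link ] e ∈ L × Straddles (x , y) e
leaving-link 1≤x y≤n (inj₁ cyc) in-p out-q = ⊥-elim (cycle-edge-¬leaves 1≤x y≤n cyc in-p out-q)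
leaving-link _ _ (inj₂ (inj₁ pq∈L)) in-p out-q = _ , pq∈L , inj₁ (in-p , out-q)
leaving-link _ _ (inj₂ (inj₂ qp∈L)) in-p out-q = _ , qp∈L , inj₂ (out-q , in-p)

chord-between : ∀ {n x y} → 1 ≤ x → suc x < y → y ≤ n → ¬ (x ≡ 1 × y ≡ n) → IsChord n (x , y)
chord-between {x = x} 1≤x 1+x<y y≤n ¬1n =
  1≤x , <-trans (n<1+n x) 1+x<y , y≤n , (λ y≡1+x → <-irrefl (sym y≡1+x) 1+x<y) , ¬1n

-- Deleting x and y separates the two arcs of the cycle, so some link joins them.
chord-straddled : ∀ {n L x y} → Feasible n L → IsChord n (x , y) → Σ[ e ∈ Link ] e ∈ L × Straddles (x , y) e
chord-straddled {n} {L} {x} {y} (_ , conn) (1≤x , x<y , y≤n , y≢1+x , ¬1n) =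
  [ leave (≤-refl , 1≤n) , leave (1≤n , ≤-refl) ] (outside-corner 1≤x y≤n ¬1n)
  where
    1≤n = ≤-trans 1≤x (≤-trans (<⇒≤ x<y) y≤n)
    Avoid : ℕ → Set
    Avoid v = Vertex n v × v ∉ x ∷ y ∷ []
    ∉xy : ∀ {v} → v ≢ x → v ≢ y → v ∉ x ∷ y ∷ []
    ∉xy v≢x v≢y (here v≡x) = v≢x v≡x
    ∉xy v≢x v≢y (there (here v≡y)) = v≢y v≡y
    in-u : Inside (x , y) (suc x)
    in-u = ≤-refl , ≤∧≢⇒< x<y (y≢1+x ∘ sym)
    start : Avoid (suc x)
    start = (s≤s z≤n , ≤-trans (<⇒≤ (proj₂ in-u)) y≤n) , ∉xy (>⇒≢ (proj₁ in-u)) (<⇒≢ (proj₂ in-u))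
    avoid-outside : ∀ {w} → Vertex n w → Outside (x , y) w → Avoid w
    avoid-outside vw (inj₁ w<x) = vw , ∉xy (<⇒≢ w<x) (<⇒≢ (<-trans w<x x<y))
    avoid-outside vw (inj₂ y<w) = vw , ∉xy (>⇒≢ (<-trans x<y y<w)) (>⇒≢ y<w)
    inside : ∀ {p} → Avoid p → ¬ Outside (x , y) p → Inside (x , y) p
    inside (_ , p∉) ¬out with inside-or-outside (p∉ ∘ here) (p∉ ∘ there ∘ here)
    ... | inj₁ in-p = in-p
    ... | inj₂ out-p = ⊥-elim (¬out out-p)
    exit : ∀ {w} → Path Avoid (Adj n L) (suc x) w → Outside (x , y) w → Σ[ e ∈ Link ] e ∈ L × Straddles (x , y) e
    exit path out-w with firstEntry (outside? (x , y)) start path (inside⇒¬outside in-u) out-w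
    ... | p , q , (ap , ¬out-p) , p~q , (_ , out-q) = leaving-link 1≤x y≤n p~q (inside ap ¬out-p) out-q
    leave : ∀ {w} → Vertex n w → Outside (x , y) w → Σ[ e ∈ Link ] e ∈ L × Straddles (x , y) e
    leave {w} vw out-w = exit (conn (x ∷ y ∷ []) (s≤s (s≤s z≤n)) (suc x) w start (avoid-outside vw out-w)) out-w

Convex : (ℕ → Set) → Set
Convex P = ∀ {i j k} → P i → P j → i ≤ k → k ≤ j → P k

module _ {n : ℕ} {L : List Link} {P : ℕ → Set} (convex : Convex P) where

  ascend : ∀ {i j} → P i → P j → i ≤′ j → Path P (Adj n L) i j
  ascend pi pj ≤′-refl = here
  ascend pi pj (≤′-step i≤′j) = snoc (ascend pi (convex pi pj (≤′⇒≤ i≤′j) (n≤1+n _)) i≤′j) (inj₁ (inj₁ refl)) pj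

  convex-path : ∀ {i j} → P i → P j → Path P (Adj n L) i j
  convex-path {i} {j} pi pj with ≤-total i j
  ... | inj₁ i≤j = ascend pi pj (≤⇒≤′ i≤j)
  ... | inj₂ j≤i = reverse adj-sym pj (ascend pj pi (≤⇒≤′ j≤i))

Avoiding : ℕ → ℕ → ℕ → ℕ → Set
Avoiding n x y v = Vertex n v × v ≢ x × v ≢ y

-- 0 is not a vertex, so it can stand for a removed vertex that is not there.
covering-pair : (X : List ℕ) → length X ≤ 2 →
                Σ[ x ∈ ℕ ] Σ[ y ∈ ℕ ] x ≤ y × x ∈ 0 ∷ X × y ∈ 0 ∷ X × (∀ {v} → v ∈ X → v ≡ x ⊎ v ≡ y)
covering-pair [] _ = 0 , 0 , z≤n , here refl , here refl , λ ()
covering-pair (z ∷ []) _ = z , z , ≤-refl , there (here refl) , there (here refl) , λ { (here e) → inj₁ e }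
covering-pair (z ∷ z′ ∷ []) _ with ≤-total z z′
... | inj₁ z≤z′ = z , z′ , z≤z′ , there (here refl) , there (there (here refl)) ,
                  λ { (here e) → inj₁ e ; (there (here e)) → inj₂ e }
... | inj₂ z′≤z = z′ , z , z′≤z , there (there (here refl)) , there (here refl) ,
                  λ { (here e) → inj₂ e ; (there (here e)) → inj₁ e }
covering-pair (_ ∷ _ ∷ _ ∷ _) (s≤s (s≤s ()))

connected-after-removal : ∀ {n} {E : ℕ → ℕ → Set} → (∀ {x y} → x ≤ y → Connected (Avoiding n x y) E) →
                          ∀ X → length X ≤ 2 → Connected (λ v → Vertex n v × v ∉ X) E
connected-after-removal {n} conn X |X|≤2 u w (vu , u∉X) (vw , w∉X) with covering-pair X |X|≤2
... | x , y , x≤y , x∈ , y∈ , X⊆xy =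
  weaken (λ (vv , v≢x , v≢y) → vv , [ v≢x , v≢y ] ∘ X⊆xy)
    (conn x≤y u w (vu , avoid vu u∉X x∈ , avoid vu u∉X y∈) (vw , avoid vw w∉X x∈ , avoid vw w∉X y∈))
  where
    avoid : ∀ {v z} → Vertex n v → v ∉ X → z ∈ 0 ∷ X → v ≢ z
    avoid (() , _) _ (here refl) refl
    avoid _ v∉X (there z∈X) refl = v∉X z∈X

module Backward (n : ℕ) (L : List Link) (chords : ∀ c → c ∈ L → IsChord n c)
                (cover : EdgeCover n L) (component : CircleComponent L)
                {x y : ℕ} (x≤y : x ≤ y) where

  Middle : ℕ → Set
  Middle v = Vertex n v × Inside (x , y) v

  Outer : ℕ → Set
  Outer v = Vertex n v × Outside (x , y) v

  middle-convex : Convex Middle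
  middle-convex ((1≤i , _) , x<i , _) ((_ , j≤n) , _ , j<y) i≤k k≤j =
    (≤-trans 1≤i i≤k , ≤-trans k≤j j≤n) , <-≤-trans x<i i≤k , ≤-<-trans k≤j j<y

  Below : ℕ → Set
  Below v = Vertex n v × v < x

  Above : ℕ → Set
  Above v = Vertex n v × y < v

  below-convex : Convex Below
  below-convex ((1≤i , _) , _) ((_ , j≤n) , j<x) i≤k k≤j =
    (≤-trans 1≤i i≤k , ≤-trans k≤j j≤n) , ≤-<-trans k≤j j<x

  above-convex : Convex Above
  above-convex ((1≤i , _) , y<i) ((_ , j≤n) , _) i≤k k≤j =
    (≤-trans 1≤i i≤k , ≤-trans k≤j j≤n) , <-≤-trans y<i i≤k

  middle⇒avoiding : ∀ {v} → Middle v → Avoiding n x y v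
  middle⇒avoiding (vv , x<v , v<y) = vv , >⇒≢ x<v , <⇒≢ v<y

  below⇒avoiding : ∀ {v} → Below v → Avoiding n x y v
  below⇒avoiding (vv , v<x) = vv , <⇒≢ v<x , <⇒≢ (<-≤-trans v<x x≤y)

  above⇒avoiding : ∀ {v} → Above v → Avoiding n x y v
  above⇒avoiding (vv , y<v) = vv , >⇒≢ (≤-<-trans x≤y y<v) , >⇒≢ y<v

  outer⇒avoiding : ∀ {v} → Outer v → Avoiding n x y v
  outer⇒avoiding (vv , inj₁ v<x) = below⇒avoiding (vv , v<x)
  outer⇒avoiding (vv , inj₂ y<v) = above⇒avoiding (vv , y<v)

  region : ∀ {v} → Avoiding n x y v → Middle v ⊎ Outer v
  region (vv , v≢x , v≢y) with inside-or-outside v≢x v≢y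
  ... | inj₁ in-v  = inj₁ (vv , in-v)
  ... | inj₂ out-v = inj₂ (vv , out-v)

  middle-path : ∀ {u w} → Middle u → Middle w → Path (Avoiding n x y) (Adj n L) u w
  middle-path mu mw = weaken middle⇒avoiding (convex-path middle-convex mu mw)

  below-path : ∀ {u w} → Below u → Below w → Path (Avoiding n x y) (Adj n L) u w
  below-path bu bw = weaken below⇒avoiding (convex-path below-convex bu bw)

  above-path : ∀ {u w} → Above u → Above w → Path (Avoiding n x y) (Adj n L) u w
  above-path au aw = weaken above⇒avoiding (convex-path above-convex au aw)

  around : ∀ {u w} → Below u → Above w → Path (Avoiding n x y) (Adj n L) u w
  around bu@((1≤u , u≤n) , u<x) aw@((_ , w≤n) , y<w) =
    below-path bu first
    ++ₚ step (inj₁ (inj₂ (inj₂ (inj₁ (refl , refl))))) (above⇒avoiding last) (above-path last aw)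
    where
      1≤n = ≤-trans 1≤u u≤n
      first : Below 1
      first = (≤-refl , 1≤n) , ≤-<-trans 1≤u u<x
      last : Above n
      last = (1≤n , ≤-refl) , <-≤-trans y<w w≤n

  outer-path : ∀ {u w} → Outer u → Outer w → Path (Avoiding n x y) (Adj n L) u w
  outer-path (vu , inj₁ u<x) (vw , inj₁ w<x) = below-path (vu , u<x) (vw , w<x)
  outer-path (vu , inj₂ y<u) (vw , inj₂ y<w) = above-path (vu , y<u) (vw , y<w)
  outer-path (vu , inj₁ u<x) (vw , inj₂ y<w) = around (vu , u<x) (vw , y<w)
  outer-path (vu , inj₂ y<u) (vw , inj₁ w<x) =
    reverse adj-sym (below⇒avoiding (vw , w<x)) (around (vw , w<x) (vu , y<u))

  bridge : ∀ {u w} → Middle u → Outer w → ∃₂ λ p q → Middle p × Outer q × Adj n L p q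
  bridge {u} {w} (vu , in-u) (vw , out-w) with cover u vu | cover w vw
  ... | r , r∈L , u∈r | r′ , r′∈L , w∈r′
    with straddler-on-path (x , y) (component r r′ r∈L r′∈L) r∈L
           (touches-endpoint r u∈r in-u) (touches-endpoint r′ w∈r′ out-w)
  ... | (a , b) , s∈L , straddle with chord-endpoints (chords _ s∈L) | straddle
  ...   | va , vb | inj₁ (in-a , out-b) = a , b , (va , in-a) , (vb , out-b) , inj₂ (inj₁ s∈L)
  ...   | va , vb | inj₂ (out-a , in-b) = b , a , (vb , in-b) , (va , out-a) , inj₂ (inj₂ s∈L)

  through : ∀ {u w} → Middle u → Outer w → Path (Avoiding n x y) (Adj n L) u w
  through mu ow with bridge mu ow
  ... | p , q , mp , oq , p~q = middle-path mu mp ++ₚ step p~q (outer⇒avoiding oq) (outer-path oq ow)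

  connected : Connected (Avoiding n x y) (Adj n L)
  connected u w au aw with region au | region aw
  ... | inj₁ mu | inj₁ mw = middle-path mu mw
  ... | inj₂ ou | inj₂ ow = outer-path ou ow
  ... | inj₁ mu | inj₂ ow = through mu ow
  ... | inj₂ ou | inj₁ mw = reverse adj-sym aw (through mw ou)

record CrossingClosure (L : List Link) (c : Link) : Set where
  field
    members   : List Link
    ⊆L        : members ⊆ₗ L
    c∈        : c ∈ members
    reachable : ∀ {r} → r ∈ members → Path (_∈ members) Cross c r
    closed    : ∀ {r e} → r ∈ members → e ∈ L → Cross r e → e ∈ members

module _ (L : List Link) (c : Link) where

  record Frontier (R U : List Link) : Set where
    field
      R⊆L   : R ⊆ₗ L
      U⊆L   : U ⊆ₗ L
      c∈R   : c ∈ R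
      reach : ∀ {r} → r ∈ R → Path (_∈ R) Cross c r
      L⊆R∪U : ∀ {e} → e ∈ L → e ∈ R ⊎ e ∈ U

  CrossedBy : List Link → Link → Set
  CrossedBy R e = Any (λ r → Cross r e) R

  crossedBy? : ∀ R → Decidable (CrossedBy R)
  crossedBy? R e = any? (λ r → cross? r e) R

  advance : ∀ {R U} → Frontier R U →
            Frontier (filter (crossedBy? R) U ++ R) (filter (¬? ∘ crossedBy? R) U)
  advance {R} {U} F = record
    { R⊆L   = λ e e∈ → [ U⊆L e ∘ proj₁ ∘ new-crossed , R⊆L e ] (∈-++⁻ new e∈)
    ; U⊆L   = λ e e∈ → U⊆L e (proj₁ (∈-filter⁻ (¬? ∘ crossedBy? R) {xs = U} e∈))
    ; c∈R   = ∈-++⁺ʳ new c∈R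
    ; reach = λ r∈ → [ reach-new , weaken (∈-++⁺ʳ new) ∘ reach ] (∈-++⁻ new r∈)
    ; L⊆R∪U = sort ∘ L⊆R∪U
    }
    where
      open Frontier F
      new = filter (crossedBy? R) U
      new-crossed : ∀ {e} → e ∈ new → e ∈ U × CrossedBy R e
      new-crossed = ∈-filter⁻ (crossedBy? R) {xs = U}
      reach-new : ∀ {e} → e ∈ new → Path (_∈ new ++ R) Cross c e
      reach-new e∈new with find (proj₂ (new-crossed e∈new))
      ... | r , r∈R , r×e = snoc (weaken (∈-++⁺ʳ new) (reach r∈R)) r×e (∈-++⁺ˡ e∈new)
      sort : ∀ {e} → e ∈ R ⊎ e ∈ U → e ∈ new ++ R ⊎ e ∈ filter (¬? ∘ crossedBy? R) U
      sort (inj₁ e∈R) = inj₁ (∈-++⁺ʳ new e∈R)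
      sort {e} (inj₂ e∈U) with crossedBy? R e
      ... | yes crossed = inj₁ (∈-++⁺ˡ (∈-filter⁺ (crossedBy? R) e∈U crossed))
      ... | no ¬crossed = inj₂ (∈-filter⁺ (¬? ∘ crossedBy? R) e∈U ¬crossed)

  grow : ∀ R U → Frontier R U → Acc _<_ (length U) → CrossingClosure L c
  grow R U F (acc smaller) with any? (crossedBy? R) U
  ... | yes some =
    grow _ _ (advance F) (smaller (filter-notAll (¬? ∘ crossedBy? R) U (Any.map (λ q ¬q → ¬q q) some)))
  ... | no none = record { members = R ; ⊆L = R⊆L ; c∈ = c∈R ; reachable = reach ; closed = closed }
    where
      open Frontier F
      closed : ∀ {r e} → r ∈ R → e ∈ L → Cross r e → e ∈ R
      closed r∈R e∈L r×e = [ id , (λ e∈U → ⊥-elim (none (lose e∈U (lose r∈R r×e)))) ] (L⊆R∪U e∈L)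

  crossing-closure : c ∈ L → CrossingClosure L c
  crossing-closure c∈L = grow (c ∷ []) L initial (<-wellFounded (length L))
    where
      initial : Frontier (c ∷ []) L
      initial = record
        { R⊆L = λ { _ (here refl) → c∈L } ; U⊆L = λ _ e∈ → e∈ ; c∈R = here refl
        ; reach = λ { (here refl) → here } ; L⊆R∪U = inj₂ }

endpoints : List Link → List ℕ
endpoints [] = []
endpoints ((a , b) ∷ R) = a ∷ b ∷ endpoints R

endpoints-any⁺ : ∀ {P : ℕ → Set} {r} R → r ∈ R → Touches P r → Any P (endpoints R)
endpoints-any⁺ (_ ∷ R) (here refl) (inj₁ pa) = here pa
endpoints-any⁺ (_ ∷ R) (here refl) (inj₂ pb) = there (here pb)
endpoints-any⁺ (_ ∷ R) (there r∈R) t = there (there (endpoints-any⁺ R r∈R t))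

endpoints-any⁻ : ∀ {P : ℕ → Set} R → Any P (endpoints R) → Σ[ r ∈ Link ] r ∈ R × Touches P r
endpoints-any⁻ (r ∷ R) (here pa) = r , here refl , inj₁ pa
endpoints-any⁻ (r ∷ R) (there (here pb)) = r , here refl , inj₂ pb
endpoints-any⁻ (r ∷ R) (there (there p)) with endpoints-any⁻ R p
... | r′ , r′∈R , t = r′ , there r′∈R , t

module Forward (n : ℕ) (L : List Link) (chords : ∀ c → c ∈ L → IsChord n c)
               (feasible : Feasible n L) {c : Link} (K : CrossingClosure L c) where
  open CrossingClosure K renaming (members to R)

  Ends : List ℕ
  Ends = endpoints R

  member-chord : ∀ {r} → r ∈ R → IsChord n r
  member-chord r∈R = chords _ (⊆L _ r∈R)

  ends-vertex : ∀ {v} → v ∈ Ends → Vertex n v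
  ends-vertex v∈ with endpoints-any⁻ R v∈
  ... | r , r∈R , inj₁ refl = proj₁ (chord-endpoints (member-chord r∈R))
  ... | r , r∈R , inj₂ refl = proj₂ (chord-endpoints (member-chord r∈R))

  path-within : ∀ {r r′} → r ∈ R → r′ ∈ R → Path (_∈ R) Cross r r′
  path-within r∈ r′∈ = reverse cross-sym c∈ (reachable r∈) ++ₚ reachable r′∈

  separator∈R : ∀ {e} → e ∈ L → Any (Inside e) Ends → Any (Outside e) Ends → e ∈ R
  separator∈R {e} e∈L some-in some-out with endpoints-any⁻ R some-in | endpoints-any⁻ R some-out
  ... | r , r∈R , in-r | r′ , r′∈R , out-r′ with straddler-on-path e (path-within r∈R r′∈R) r∈R in-r out-r′
  ...   | s , s∈R , straddle = closed s∈R e∈L (straddles⇒cross (proj₁ (proj₂ (member-chord s∈R))) straddle)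

  pair-touches : ∀ {P : ℕ → Set} {x y} → x ∈ Ends → y ∈ Ends → Touches P (x , y) → Any P Ends
  pair-touches x∈ _ (inj₁ px) = lose x∈ px
  pair-touches _ y∈ (inj₂ py) = lose y∈ py

  absorbed : ∀ {x y e} → x ∈ Ends → y ∈ Ends → e ∈ L → Straddles (x , y) e → e ∈ R
  absorbed x∈ y∈ e∈L straddle = separator∈R e∈L (pair-touches x∈ y∈ (straddles⇒touches-inside back))
                                               (pair-touches x∈ y∈ (straddles⇒touches-outside back))
    where back = straddles-sym (proj₁ (proj₂ (chords _ e∈L))) straddle

  ends-on-both-sides : ∀ {x y} → x ∈ Ends → y ∈ Ends → IsChord n (x , y) →
                       Any (Inside (x , y)) Ends × Any (Outside (x , y)) Ends
  ends-on-both-sides x∈ y∈ xy with chord-straddled feasible xy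
  ... | e , e∈L , straddle =
    touching (straddles⇒touches-inside straddle) , touching (straddles⇒touches-outside straddle)
    where
      touching : ∀ {P : ℕ → Set} → Touches P e → Any P Ends
      touching = endpoints-any⁺ R (absorbed x∈ y∈ e∈L straddle)

  c₁∈ : proj₁ c ∈ Ends
  c₁∈ = endpoints-any⁺ R c∈ (inj₁ refl)

  c₂∈ : proj₂ c ∈ Ends
  c₂∈ = endpoints-any⁺ R c∈ (inj₂ refl)

  c-gap : suc (proj₁ c) < proj₂ c
  c-gap with member-chord c∈
  ... | _ , c₁<c₂ , _ , c₂≢1+c₁ , _ = ≤∧≢⇒< c₁<c₂ (c₂≢1+c₁ ∘ sym)

  interior-endpoint : Any (Inside (1 , n)) Ends
  interior-endpoint with member-chord c∈ | proj₁ c ≟ 1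
  ... | 1≤c₁ , c₁<c₂ , c₂≤n , _ , _   | no c₁≢1 =
        endpoints-any⁺ R c∈ (inj₁ (≤∧≢⇒< 1≤c₁ (c₁≢1 ∘ sym) , <-≤-trans c₁<c₂ c₂≤n))
  ... | 1≤c₁ , c₁<c₂ , c₂≤n , _ , ¬1n | yes c₁≡1 =
        endpoints-any⁺ R c∈ (inj₂ (≤-<-trans 1≤c₁ c₁<c₂ , ≤∧≢⇒< c₂≤n (λ c₂≡n → ¬1n (c₁≡1 , c₂≡n))))

  hull-absurd : ∀ {x y} → x ∈ Ends → y ∈ Ends → (∀ {v} → v ∈ Ends → x ≤ v) → (∀ {v} → v ∈ Ends → v ≤ y) →
                ¬ (x ≡ 1 × y ≡ n) → ⊥
  hull-absurd {x} {y} x∈ y∈ x≤ ≤y ¬1n = beyond-hull (proj₂ (ends-on-both-sides x∈ y∈ (chord-between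
    (proj₁ (ends-vertex x∈)) (≤-<-trans (s≤s (x≤ c₁∈)) (<-≤-trans c-gap (≤y c₂∈))) (proj₂ (ends-vertex y∈)) ¬1n)))
    where
      beyond-hull : ¬ Any (Outside (x , y)) Ends
      beyond-hull some with find some
      ... | v , v∈ , inj₁ v<x = <⇒≱ v<x (x≤ v∈)
      ... | v , v∈ , inj₂ y<v = <⇒≱ y<v (≤y v∈)

  ¬¬reaches-1-and-n : ¬ ¬ (1 ∈ Ends × n ∈ Ends)
  ¬¬reaches-1-and-n ¬both = hull (least U? Ends (lose c₁∈ tt)) (greatest ≤-totalPreorder U? Ends (lose c₁∈ tt))
    where
      hull : Least U Ends → Greatest ≤-totalPreorder U Ends → ⊥
      hull (x , x∈ , _ , x≤) (y , y∈ , _ , ≤y) = hull-absurd x∈ y∈ (λ v∈ → x≤ v∈ tt) (λ v∈ → ≤y v∈ tt)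
        λ (x≡1 , y≡n) → ¬both (subst (_∈ Ends) x≡1 x∈ , subst (_∈ Ends) y≡n y∈)

  reaches-1-and-n : 1 ∈ Ends × n ∈ Ends
  reaches-1-and-n = decidable-stable (any? (1 ≟_) Ends ×-dec any? (n ≟_) Ends) ¬¬reaches-1-and-n

  1∈Ends : 1 ∈ Ends
  1∈Ends = proj₁ reaches-1-and-n

  n∈Ends : n ∈ Ends
  n∈Ends = proj₂ reaches-1-and-n

  corner-end : ∀ {P : ℕ → Set} → P 1 ⊎ P n → Any P Ends
  corner-end = [ lose 1∈Ends , lose n∈Ends ]

  gap-absurd : ∀ {x y} → x ∈ Ends → y ∈ Ends → suc x < y → ¬ Any (Inside (x , y)) Ends → ⊥
  gap-absurd x∈ y∈ 1+x<y empty = empty (proj₁ (ends-on-both-sides x∈ y∈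
    (chord-between (proj₁ (ends-vertex x∈)) 1+x<y (proj₂ (ends-vertex y∈)) λ (x≡1 , y≡n) →
       empty (subst₂ (λ a b → Any (Inside (a , b)) Ends) (sym x≡1) (sym y≡n) interior-endpoint))))

  nearest-ends-absurd : ∀ {a b} → suc a < b → ¬ Any (Inside (a , b)) Ends →
                        Greatest ≤-totalPreorder (_≤ a) Ends → Least (b ≤_) Ends → ⊥
  nearest-ends-absurd {a} {b} 1+a<b none (x , x∈ , x≤a , ≤x) (y , y∈ , b≤y , y≤) =
    gap-absurd x∈ y∈ (≤-<-trans (s≤s x≤a) (<-≤-trans 1+a<b b≤y)) empty
    where
      empty : ¬ Any (Inside (x , y)) Ends
      empty some with find some
      ... | v , v∈ , x<v , v<y with v ≤? a | b ≤? v
      ...   | yes v≤a | _       = <⇒≱ x<v (≤x v∈ v≤a)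
      ...   | no _    | yes b≤v = <⇒≱ v<y (y≤ v∈ b≤v)
      ...   | no v≰a  | no b≰v  = none (lose v∈ (≰⇒> v≰a , ≰⇒> b≰v))

  ¬¬complete : ∀ {d} → d ∈ L → ¬ ¬ d ∈ R
  ¬¬complete {a , b} d∈L d∉R with chords _ d∈L | any? (inside? (a , b)) Ends
  ... | 1≤a , _ , b≤n , _ , ¬1n | yes some-in =
        d∉R (separator∈R d∈L some-in (corner-end (outside-corner 1≤a b≤n ¬1n)))
  ... | 1≤a , a<b , b≤n , b≢1+a , _ | no none =
        nearest-ends-absurd (≤∧≢⇒< a<b (b≢1+a ∘ sym)) none
          (greatest ≤-totalPreorder (_≤? a) Ends (lose 1∈Ends 1≤a)) (least (b ≤?_) Ends (lose n∈Ends b≤n))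

  complete : ∀ {d} → d ∈ L → d ∈ R
  complete d∈L = decidable-stable (any? (link-≟ _) R) (¬¬complete d∈L)

lemma3 : (n : ℕ) (S S' : List Link) →
    CycleVCAInstance n S → S' ⊆ₗ S → EdgeCover n S' →
    (Feasible n S' ⇔ CircleComponent S')
lemma3 n S S' (4≤n , S-chords , _) S'⊆S cover = mk⇔ circle-component feasible
  where
    chords : ∀ c → c ∈ S' → IsChord n c
    chords c c∈ = S-chords c (S'⊆S c c∈)

    circle-component : Feasible n S' → CircleComponent S'
    circle-component F c d c∈ d∈ = weaken (⊆L _) (reachable (Forward.complete n S' chords F K d∈))
      where
        K = crossing-closure S' c c∈
        open CrossingClosure K

    feasible : CircleComponent S' → Feasible n S'
    feasible cc = 4≤n , connected-after-removal (λ x≤y → Backward.connected n S' chords cover cc x≤y)
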